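{- Let $G$ and $H$ be graphs and let $\ell\ge1$ be an integer. If $G$ has an $H$-partition of layered width $\ell$, then $\operatorname{tn}(G)\le 3\ell\cdot\operatorname{tn}(H)$.
   Context: All graphs are finite, simple and undirected. A $t$-track assignment of a graph $G=(V,E)$ is a partition of $V$ into $t$ sets $V_1,\dots,V_t$ (tracks), each an independent set of $G$, together with a total order $<_i$ on each $V_i$. An X-crossing consists of two edges $(u,v)$ and $(x,y)$ with $u,x\in V_i$, $v,y\in V_j$ ($i\neq j$), $u<_i x$ and $y<_j v$. A $t$-track layout is a $t$-track assignment with no X-crossing, and $\operatorname{tn}(G)$ is the minimum $t$ such that $G$ has a $t$-track layout. An $H$-partition of $G$ is a partition of $V(G)$ into disjoint sets (bags) $\{A_x : x\in V(H)\}$ indexed by the vertices of $H$ such that for every edge $(u,v)\in E(G)$ either $u,v\in A_x$ for some $x\in V(H)$, or there is an edge $(x,y)\in E(H)$ with $u\in A_x$ and $v\in A_y$. A layering of $G$ is an ordered partition $(V_0,V_1,\dots)$ of $V(G)$ such that for every edge $(v,w)$ with $v\in V_i$, $w\in V_j$ we have $|i-j|\le1$. The layered width of an $H$-partition is the minimum integer $\ell$ such that for some layering $(V_0,V_1,\dots)$ of $G$, $|A_x\cap V_i|\le\ell$ for every bag $A_x$ and every $i\ge0$. -}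

module Defs where

open import Data.Nat using (ℕ; zero; suc; _+_; _*_; _≤_; _<_; ∣_-_∣)
open import Data.Fin using (Fin)
open import Data.Fin.Properties using () renaming (_≟_ to _≟ᶠ_)
open import Data.Nat.Properties using () renaming (_≟_ to _≟ⁿ_)
open import Data.List using (List; length; filter; tabulate)
open import Data.Product using (Σ; _×_; _,_)
open import Data.Sum using (_⊎_)
open import Data.Empty using (⊥)
open import Relation.Nullary using (¬_)
open import Relation.Nullary.Decidable using (_×-dec_)
open import Relation.Binary.PropositionalEquality using (_≡_; _≢_)

allV : (n : ℕ) → List (Fin n)
allV n = tabulate (λ i → i)

record Graph : Set₁ where
  field
    n      : ℕ
    Adj    : Fin n → Fin n → Set
    sym    : ∀ {u v} → Adj u v → Adj v u
    irrefl : ∀ {u} → ¬ Adj u u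

V : Graph → Set
V G = Fin (Graph.n G)

record TrackLayout (G : Graph) (t : ℕ) : Set₁ where
  open Graph G
  field
    track   : V G → Fin t
    indep   : ∀ {u v} → Adj u v → track u ≢ track v
    _≺_     : V G → V G → Set
    ≺-irrefl : ∀ {u} → ¬ (u ≺ u)
    ≺-trans  : ∀ {u v w} → track u ≡ track v → track v ≡ track w →
               u ≺ v → v ≺ w → u ≺ w
    ≺-total  : ∀ {u v} → track u ≡ track v → u ≢ v → (u ≺ v) ⊎ (v ≺ u)
    noX     : ∀ {u v x y} → Adj u v → Adj x y →
              track u ≡ track x → track v ≡ track y → track u ≢ track v →
              u ≺ x → y ≺ v → ⊥

HasTrackLayout : Graph → ℕ → Set₁
HasTrackLayout G t = TrackLayout G t

IsTrackNumber : Graph → ℕ → Set₁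
IsTrackNumber G t = HasTrackLayout G t × (∀ s → s < t → ¬ HasTrackLayout G s)

-- An H-partition of G, given by the bag map V(G) → V(H)
-- (vertex v lies in bag A_{bag v}).
record HPartition (G H : Graph) : Set where
  field
    bag   : V G → V H
    edges : ∀ {u v} → Graph.Adj G u v →
            (bag u ≡ bag v) ⊎ Graph.Adj H (bag u) (bag v)

IsLayering : (G : Graph) → (V G → ℕ) → Set
IsLayering G layer = ∀ {u v} → Graph.Adj G u v → ∣ layer u - layer v ∣ ≤ 1

bagLayerSize : (G H : Graph) → HPartition G H → (V G → ℕ) → V H → ℕ → ℕ
bagLayerSize G H P layer x i =
  length (filter (λ v → (HPartition.bag P v ≟ᶠ x) ×-dec (layer v ≟ⁿ i)) (allV (Graph.n G)))

LayeredWidthAtMost : (G H : Graph) → HPartition G H → ℕ → Set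
LayeredWidthAtMost G H P ℓ =
  Σ (V G → ℕ) λ layer → IsLayering G layer ×
    (∀ x i → bagLayerSize G H P layer x i ≤ ℓ)

HasLayeredWidth : (G H : Graph) → HPartition G H → ℕ → Set
HasLayeredWidth G H P ℓ =
  LayeredWidthAtMost G H P ℓ × (∀ k → k < ℓ → ¬ LayeredWidthAtMost G H P k)

-- Put v on the track (layer of v mod 3, rank of v inside its bag-layer class, H-track of its
-- bag), and order a track by layer first and then by the H-order of the bags.  A bag-layer class
-- has at most ℓ members, so the rank fits in Fin ℓ and separates the vertices of a class.  The
-- endpoints of two edges whose ends share tracks lie in at most three consecutive layers, so equal
-- residues mod 3 force equal layers; an X-crossing in G then maps to an X-crossing in H, to an
-- H-edge inside a track of H, or (when both edges lie inside bags) to a cycle in the order of one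
-- track of H.

module Submission where

open import Defs
open import Data.Nat using (ℕ; ∣_-_∣; suc; _+_; _*_; _≤_; _<_; NonZero; s≤s; s≤s⁻¹; z≤n)
open import Data.Nat.Properties
  using (≤-trans; ≤-antisym; ≤-reflexive; <⇒≤; <⇒≢; <-irrefl; <-≤-trans; ≤-<-trans;
         <-cmp; ≤-total; ≮⇒≥; m≤n⇒m≤1+n; +-assoc; +-comm; +-monoʳ-≤;
         +-cancelˡ-<; *-cancelʳ-<; m≤n+∣m-n∣; module ≤-Reasoning)
  renaming (_≟_ to _≟ⁿ_)
open import Data.Nat.DivMod using (_%_; _/_; _mod_; m≡m%n+[m/n]*n; /-monoˡ-≤)
open import Data.Fin as Fin using (Fin; combine; fromℕ<)
open import Data.Fin.Properties as Finₚ using (combine-injective; fromℕ<-injective)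
open import Data.List using ([]; _∷_; length; filter)
open import Data.List.Membership.Propositional using (_∈_)
open import Data.List.Membership.Propositional.Properties using (∈-tabulate⁺)
open import Data.List.Relation.Unary.Any using (here; there)
open import Data.Product using (_×_; _,_; proj₁; proj₂)
open import Data.Product.Properties using (≡-dec; ×-≡,≡←≡)
open import Data.Sum as Sum using (_⊎_; inj₁; inj₂)
open import Data.Empty using (⊥)
open import Function using (_∘_)
open import Relation.Nullary using (¬_; yes; no; contradiction)
open import Relation.Nullary.Decidable using (_×-dec_)
open import Relation.Unary using (Decidable; _⊆_)
open import Relation.Binary using (DecidableEquality; tri<; tri≈; tri>)
open import Relation.Binary.PropositionalEquality
  using (_≡_; _≢_; refl; sym; trans; cong; cong₂; subst; module ≡-Reasoning)

module _ {A : Set} {P Q : A → Set} (P? : Decidable P) (Q? : Decidable Q) (P⊆Q : P ⊆ Q) where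

  length-filter-mono-≤ : ∀ xs → length (filter P? xs) ≤ length (filter Q? xs)
  length-filter-mono-≤ [] = z≤n
  length-filter-mono-≤ (x ∷ xs) with P? x | Q? x
  ... | yes _  | yes _  = s≤s (length-filter-mono-≤ xs)
  ... | yes px | no ¬qx = contradiction (P⊆Q px) ¬qx
  ... | no _   | yes _  = m≤n⇒m≤1+n (length-filter-mono-≤ xs)
  ... | no _   | no _   = length-filter-mono-≤ xs

  length-filter-mono-< : ∀ {a xs} → a ∈ xs → Q a → ¬ P a →
                         length (filter P? xs) < length (filter Q? xs)
  length-filter-mono-< {xs = x ∷ xs} (here refl) qa ¬pa with P? x | Q? x
  ... | yes pa | _      = contradiction pa ¬pa
  ... | no _   | yes _  = s≤s (length-filter-mono-≤ xs)
  ... | no _   | no ¬qa = contradiction qa ¬qa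
  length-filter-mono-< {xs = x ∷ xs} (there a∈xs) qa ¬pa with P? x | Q? x
  ... | yes _  | yes _  = s≤s (length-filter-mono-< a∈xs qa ¬pa)
  ... | yes px | no ¬qx = contradiction (P⊆Q px) ¬qx
  ... | no _   | yes _  = m≤n⇒m≤1+n (length-filter-mono-< a∈xs qa ¬pa)
  ... | no _   | no _   = length-filter-mono-< a∈xs qa ¬pa

n<k+m⇒n/k≤m/k : ∀ {m n k} .{{_ : NonZero k}} → n < k + m → m % k ≡ n % k → n / k ≤ m / k
n<k+m⇒n/k≤m/k {m} {n} {k} n<k+m m%k≡n%k =
  s≤s⁻¹ (*-cancelʳ-< k _ _ (+-cancelˡ-< (n % k) _ _ (begin-strict
    n % k + n / k * k       ≡⟨ m≡m%n+[m/n]*n n k ⟨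
    n                       <⟨ n<k+m ⟩
    k + m                   ≡⟨ +-comm k m ⟩
    m + k                   ≡⟨ cong (_+ k) (m≡m%n+[m/n]*n m k) ⟩
    m % k + m / k * k + k   ≡⟨ +-assoc (m % k) _ k ⟩
    m % k + (m / k * k + k) ≡⟨ cong₂ _+_ m%k≡n%k (+-comm _ k) ⟩
    n % k + suc (m / k) * k ∎)))
  where open ≤-Reasoning

%-injective-window : ∀ {m n k} .{{_ : NonZero k}} → m ≤ n → n < k + m → m % k ≡ n % k → m ≡ n
%-injective-window {m} {n} {k} m≤n n<k+m m%k≡n%k = begin
  m                 ≡⟨ m≡m%n+[m/n]*n m k ⟩
  m % k + m / k * k ≡⟨ cong₂ (λ r q → r + q * k) m%k≡n%k m/k≡n/k ⟩
  n % k + n / k * k ≡⟨ m≡m%n+[m/n]*n n k ⟨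
  n                 ∎
  where
  open ≡-Reasoning
  m/k≡n/k : m / k ≡ n / k
  m/k≡n/k = ≤-antisym (/-monoˡ-≤ k m≤n) (n<k+m⇒n/k≤m/k n<k+m m%k≡n%k)

encode₃ : ∀ {a b c} → Fin a × Fin b × Fin c → Fin (a * b * c)
encode₃ (i , j , k) = combine (combine i j) k

encode₃-injective : ∀ {a b c} {p q : Fin a × Fin b × Fin c} → encode₃ p ≡ encode₃ q → p ≡ q
encode₃-injective {p = i , j , k} {q = i′ , j′ , k′} eq
  with combine-injective (combine i j) k (combine i′ j′) k′ eq
... | ij≡i′j′ , refl with combine-injective i j i′ j′ ij≡i′j′
...   | refl , refl = refl

module Rank {n : ℕ} {A : Set} (_≟_ : DecidableEquality A) (key : Fin n → A) where

  rank : Fin n → ℕ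
  rank v = length (filter (λ w → (key w ≟ key v) ×-dec (w Fin.<? v)) (allV n))

  sameKey? : ∀ v → Decidable (λ w → key w ≡ key v)
  sameKey? v w = key w ≟ key v

  classSize : Fin n → ℕ
  classSize v = length (filter (sameKey? v) (allV n))

  rank<classSize : ∀ v → rank v < classSize v
  rank<classSize v =
    length-filter-mono-< _ _ proj₁ (∈-tabulate⁺ v) refl (Finₚ.<-irrefl refl ∘ proj₂)

  rank-mono : ∀ {u v} → key u ≡ key v → u Fin.< v → rank u < rank v
  rank-mono {u} {v} ku≡kv u<v =
    length-filter-mono-< _ _ (λ (kw≡ku , w<u) → trans kw≡ku ku≡kv , Finₚ.<-trans w<u u<v)
      (∈-tabulate⁺ u) (ku≡kv , u<v) (Finₚ.<-irrefl refl ∘ proj₂)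

  rank-injective : ∀ {u v} → key u ≡ key v → rank u ≡ rank v → u ≡ v
  rank-injective {u} {v} ku≡kv ru≡rv with Finₚ.<-cmp u v
  ... | tri< u<v _ _ = contradiction ru≡rv (<⇒≢ (rank-mono ku≡kv u<v))
  ... | tri≈ _ u≡v _ = u≡v
  ... | tri> _ _ v<u = contradiction (sym ru≡rv) (<⇒≢ (rank-mono (sym ku≡kv) v<u))

module LayeredProductLayout
  (G H : Graph) (P : HPartition G H) (ℓ b : ℕ)
  (layer : V G → ℕ) (layering : IsLayering G layer)
  (thin : ∀ x i → bagLayerSize G H P layer x i ≤ ℓ)
  (LH : TrackLayout H b) where

  open Graph G using (Adj)
  open HPartition P
  open TrackLayout LH using () renaming (track to trackᴴ; _≺_ to _≺ᴴ_)
  module LH = TrackLayout LH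
  open Rank (≡-dec Finₚ._≟_ _≟ⁿ_) (λ v → bag v , layer v)

  layer-step : ∀ {u v} → Adj u v → layer u ≤ 1 + layer v
  layer-step {u} {v} uv = begin
    layer u                         ≤⟨ m≤n+∣m-n∣ (layer u) (layer v) ⟩
    layer v + ∣ layer u - layer v ∣ ≤⟨ +-monoʳ-≤ (layer v) (layering uv) ⟩
    layer v + 1                     ≡⟨ +-comm (layer v) 1 ⟩
    1 + layer v                     ∎
    where open ≤-Reasoning

  rank<ℓ : ∀ v → rank v < ℓ
  rank<ℓ v = <-≤-trans (rank<classSize v)
    (≤-trans classSize≤bagLayerSize (thin (bag v) (layer v)))
    where
    classSize≤bagLayerSize : classSize v ≤ bagLayerSize G H P layer (bag v) (layer v)
    classSize≤bagLayerSize = length-filter-mono-≤ (sameKey? v)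
      (λ w → (bag w Finₚ.≟ bag v) ×-dec (layer w ≟ⁿ layer v)) ×-≡,≡←≡ (allV _)

  trackCode : V G → Fin 3 × Fin ℓ × Fin b
  trackCode v = layer v mod 3 , fromℕ< (rank<ℓ v) , trackᴴ (bag v)

  track : V G → Fin (3 * ℓ * b)
  track = encode₃ ∘ trackCode

  module _ {u v : V G} where

    same-track⇒same-code : track u ≡ track v → trackCode u ≡ trackCode v
    same-track⇒same-code = encode₃-injective

    same-track⇒same-hostTrack : track u ≡ track v → trackᴴ (bag u) ≡ trackᴴ (bag v)
    same-track⇒same-hostTrack = cong (proj₂ ∘ proj₂) ∘ same-track⇒same-code

    same-track⇒≡ : track u ≡ track v → bag u ≡ bag v → layer u ≡ layer v → u ≡ v
    same-track⇒≡ same bu≡bv lu≡lv = rank-injective (cong₂ _,_ bu≡bv lu≡lv)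
      (fromℕ<-injective _ _ _ _ (cong (proj₁ ∘ proj₂) (same-track⇒same-code same)))

    same-track⇒same-layer : track u ≡ track v →
                            layer u ≤ layer v → layer v ≤ 2 + layer u → layer u ≡ layer v
    same-track⇒same-layer same lu≤lv lv≤2+lu = %-injective-window lu≤lv (s≤s lv≤2+lu)
      (fromℕ<-injective _ _ _ _ (cong proj₁ (same-track⇒same-code same)))

  adjacent-same-track⇒same-layer : ∀ {u v} → track u ≡ track v → Adj u v → layer u ≡ layer v
  adjacent-same-track⇒same-layer {u} {v} same uv with ≤-total (layer u) (layer v)
  ... | inj₁ lu≤lv = same-track⇒same-layer same lu≤lv (m≤n⇒m≤1+n (layer-step (Graph.sym G uv)))
  ... | inj₂ lv≤lu = sym (same-track⇒same-layer (sym same) lv≤lu (m≤n⇒m≤1+n (layer-step uv)))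

  _≺_ : V G → V G → Set
  u ≺ v = layer u < layer v ⊎ (layer u ≡ layer v × bag u ≺ᴴ bag v)

  ≺⇒layer-≤ : ∀ {u v} → u ≺ v → layer u ≤ layer v
  ≺⇒layer-≤ (inj₁ lu<lv)       = <⇒≤ lu<lv
  ≺⇒layer-≤ (inj₂ (lu≡lv , _)) = ≤-reflexive lu≡lv

  ≺-within-layer : ∀ {u v} → layer u ≡ layer v → u ≺ v → bag u ≺ᴴ bag v
  ≺-within-layer lu≡lv (inj₁ lu<lv)         = contradiction lu≡lv (<⇒≢ lu<lv)
  ≺-within-layer _     (inj₂ (_ , bu≺ᴴbv)) = bu≺ᴴbv

  crossing⇒same-layers : ∀ {u v x y} → Adj u v → Adj x y → track u ≡ track x → track v ≡ track y →
                         u ≺ x → y ≺ v → layer u ≡ layer x × layer y ≡ layer v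
  crossing⇒same-layers uv xy ux vy u≺x y≺v =
    same-track⇒same-layer ux lu≤lx (≤-trans (layer-step xy) (s≤s (≤-trans ly≤lv (layer-step vu)))) ,
    same-track⇒same-layer (sym vy) ly≤lv (≤-trans (layer-step vu) (s≤s (≤-trans lu≤lx (layer-step xy))))
    where
    vu = Graph.sym G uv
    lu≤lx = ≺⇒layer-≤ u≺x
    ly≤lv = ≺⇒layer-≤ y≺v

  indep : ∀ {u v} → Adj u v → track u ≢ track v
  indep {u} {v} uv same with edges uv
  ... | inj₁ bu≡bv
        with refl ← same-track⇒≡ same bu≡bv (adjacent-same-track⇒same-layer same uv)
        = Graph.irrefl G uv
  ... | inj₂ bu~bv = LH.indep bu~bv (same-track⇒same-hostTrack same)

  ≺-irrefl : ∀ {u} → ¬ (u ≺ u)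
  ≺-irrefl (inj₁ lu<lu)         = <-irrefl refl lu<lu
  ≺-irrefl (inj₂ (_ , bu≺ᴴbu)) = LH.≺-irrefl bu≺ᴴbu

  ≺-trans : ∀ {u v w} → track u ≡ track v → track v ≡ track w → u ≺ v → v ≺ w → u ≺ w
  ≺-trans _ _ (inj₁ lu<lv) v≺w                 = inj₁ (<-≤-trans lu<lv (≺⇒layer-≤ v≺w))
  ≺-trans _ _ (inj₂ (lu≡lv , _)) (inj₁ lv<lw) = inj₁ (≤-<-trans (≤-reflexive lu≡lv) lv<lw)
  ≺-trans uv vw (inj₂ (lu≡lv , bu≺bv)) (inj₂ (lv≡lw , bv≺bw)) =
    inj₂ (trans lu≡lv lv≡lw ,
          LH.≺-trans (same-track⇒same-hostTrack uv) (same-track⇒same-hostTrack vw) bu≺bv bv≺bw)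

  ≺-total : ∀ {u v} → track u ≡ track v → u ≢ v → u ≺ v ⊎ v ≺ u
  ≺-total {u} {v} same u≢v with <-cmp (layer u) (layer v)
  ... | tri< lu<lv _ _ = inj₁ (inj₁ lu<lv)
  ... | tri> _ _ lv<lu = inj₂ (inj₁ lv<lu)
  ... | tri≈ _ lu≡lv _ with bag u Finₚ.≟ bag v
  ...   | yes bu≡bv = contradiction (same-track⇒≡ same bu≡bv lu≡lv) u≢v
  ...   | no bu≢bv  = Sum.map (λ bu≺bv → inj₂ (lu≡lv , bu≺bv)) (λ bv≺bu → inj₂ (sym lu≡lv , bv≺bu))
                        (LH.≺-total (same-track⇒same-hostTrack same) bu≢bv)

  noX : ∀ {u v x y} → Adj u v → Adj x y → track u ≡ track x → track v ≡ track y →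
        track u ≢ track v → u ≺ x → y ≺ v → ⊥
  noX {u} {v} {x} {y} uv xy ux vy _ u≺x y≺v = ⊥-from (edges uv) (edges xy)
    where
    layers = crossing⇒same-layers uv xy ux vy u≺x y≺v
    bu≺bx = ≺-within-layer (proj₁ layers) u≺x
    by≺bv = ≺-within-layer (proj₂ layers) y≺v
    hux = same-track⇒same-hostTrack ux
    hvy = same-track⇒same-hostTrack vy
    ⊥-from : bag u ≡ bag v ⊎ Graph.Adj H (bag u) (bag v) →
             bag x ≡ bag y ⊎ Graph.Adj H (bag x) (bag y) → ⊥
    ⊥-from (inj₂ bu~bv) (inj₂ bx~by) = LH.noX bu~bv bx~by hux hvy (LH.indep bu~bv) bu≺bx by≺bv
    ⊥-from (inj₁ bu≡bv) (inj₂ bx~by) =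
      LH.indep bx~by (trans (sym hux) (trans (cong trackᴴ bu≡bv) hvy))
    ⊥-from (inj₂ bu~bv) (inj₁ bx≡by) =
      LH.indep bu~bv (trans hux (trans (cong trackᴴ bx≡by) (sym hvy)))
    ⊥-from (inj₁ bu≡bv) (inj₁ bx≡by) = LH.≺-irrefl (subst (bag u ≺ᴴ_) (sym bu≡bv) bu≺bv)
      where
      bu≺bv : bag u ≺ᴴ bag v
      bu≺bv = LH.≺-trans hux (trans (cong trackᴴ bx≡by) (sym hvy))
                bu≺bx (subst (_≺ᴴ bag v) (sym bx≡by) by≺bv)

  layout : TrackLayout G (3 * ℓ * b)
  layout = record
    { track    = track
    ; indep    = indep
    ; _≺_      = _≺_
    ; ≺-irrefl = ≺-irrefl
    ; ≺-trans  = ≺-trans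
    ; ≺-total  = ≺-total
    ; noX      = noX
    }

lemma6 : (G H : Graph) (ℓ : ℕ) → 1 ≤ ℓ →
    (P : HPartition G H) → HasLayeredWidth G H P ℓ →
    (a b : ℕ) → IsTrackNumber G a → IsTrackNumber H b →
    a ≤ 3 * ℓ * b
lemma6 G H ℓ _ P ((layer , layering , thin) , _) a b (_ , minimal) (LH , _) =
  ≮⇒≥ λ 3ℓb<a → minimal (3 * ℓ * b) 3ℓb<a
    (LayeredProductLayout.layout G H P ℓ b layer layering thin LH)
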